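{- Let $(g_n(k))$ and $(h_n(k))$ ($n\ge1$, $1\le k\le 2n-1$) be the unique solutions of $$f_n(k+2)-2f_n(k+1)+f_n(k)+4\,f_{n-1}(k)=0\qquad (n\ge 2,\ 1\le k\le 2n-3)$$ with, respectively, the initial values $f_1(1)=1$, $f_n(1)=0$, $f_n(2)=2\sum_kf_{n-1}(k)$ ($n\ge2$), and $f_1(1)=1$, $f_n(1)=\sum_kf_{n-1}(k)$, $f_n(2)=3\sum_kf_{n-1}(k)$ ($n\ge2$). Then for all $n\ge1$ and $1\le k\le 2n-1$, $$g_n(k)=g_n(2n-k),\qquad h_n(k)=h_n(2n-k).$$ -}

module Defs where

open import Data.Nat as ℕ using (ℕ; zero; suc; _≤_)
open import Data.Integer using (ℤ; _+_; _-_; _*_; +_)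
open import Relation.Binary.PropositionalEquality using (_≡_)

sumTo : (ℕ → ℤ) → ℕ → ℤ
sumTo u zero    = + 0
sumTo u (suc m) = sumTo u m + u (suc m)

-- Σ_k f_{n-1}(k), k ranging over 1 ≤ k ≤ 2(n-1)-1 = 2n-3
prevSum : (ℕ → ℕ → ℤ) → ℕ → ℤ
prevSum f n = sumTo (f (n ℕ.∸ 1)) (2 ℕ.* n ℕ.∸ 3)

Recurrence : (ℕ → ℕ → ℤ) → Set
Recurrence f = ∀ n k → 2 ≤ n → 1 ≤ k → k ≤ 2 ℕ.* n ℕ.∸ 3 →
  f n (k ℕ.+ 2) - + 2 * f n (k ℕ.+ 1) + f n k + + 4 * f (n ℕ.∸ 1) k ≡ + 0

IsG : (ℕ → ℕ → ℤ) → Set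
IsG f = Recurrence f × f 1 1 ≡ + 1 ×
  (∀ n → 2 ≤ n → f n 1 ≡ + 0 × f n 2 ≡ + 2 * prevSum f n)
  where open import Data.Product using (_×_)

IsH : (ℕ → ℕ → ℤ) → Set
IsH f = Recurrence f × f 1 1 ≡ + 1 ×
  (∀ n → 2 ≤ n → f n 1 ≡ prevSum f n × f n 2 ≡ + 3 * prevSum f n)
  where open import Data.Product using (_×_)

Symmetric : (ℕ → ℕ → ℤ) → Set
Symmetric f = ∀ n k → 1 ≤ n → 1 ≤ k → k ≤ 2 ℕ.* n ℕ.∸ 1 → f n k ≡ f n (2 ℕ.* n ℕ.∸ k)

module Submission where

-- Fix a row n = m + 2 and write b i = f_n(i+1), c i = f_{n-1}(i+1).
-- The recurrence says that the first differences Δb i = b(i+1) - b i satisfy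
-- Δb(i+1) = Δb i - 4 c i, hence Δb i = Δb 0 - 4 (c 0 + ... + c (i-1)).
-- If the previous row c is a palindrome, complementary partial sums add up to
-- the full row sum S, so Δb i + Δb j = 2 Δb 0 - 4 S whenever i + j = 2m + 1.
-- In both systems the boundary values give Δb 0 = f_n(2) - f_n(1) = 2 S, so the
-- differences are antipalindromic.  Telescoping then shows that b i - b j is the
-- same for all i + j = 2m + 2; at the middle i = j = m + 1 it vanishes, so b
-- is a palindrome.

open import Defs
open import Data.Nat using (ℕ)
open import Data.Integer using (ℤ)
open import Data.Product using (_×_)

open import Data.Nat as ℕ using (zero; suc; z≤n; s≤s)
import Data.Nat.Properties as ℕₚ
open import Data.Integer using (_+_; _-_; _*_; +_)
import Data.Integer.Properties as ℤₚ
open import Data.Integer.Tactic.RingSolver using (solve-∀)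
import Data.Nat.Tactic.RingSolver as ℕRing
open import Data.Product using (_,_; proj₁; proj₂)
open import Relation.Binary.PropositionalEquality

Palindromic : (ℕ → ℤ) → ℕ → Set
Palindromic c L = ∀ i → i ℕ.≤ L → c i ≡ c (L ℕ.∸ i)

partialSum : (ℕ → ℤ) → ℕ → ℤ
partialSum c zero    = + 0
partialSum c (suc t) = partialSum c t + c t

sumTo≡partialSum : ∀ u t → sumTo u t ≡ partialSum (λ i → u (suc i)) t
sumTo≡partialSum u zero    = refl
sumTo≡partialSum u (suc t) = cong (_+ u (suc t)) (sumTo≡partialSum u t)

partialSum-complement : ∀ c L → Palindromic c L →
  ∀ i j → i ℕ.+ j ≡ suc L → partialSum c i + partialSum c j ≡ partialSum c (suc L)
partialSum-complement c L pal zero j i+j≡ rewrite i+j≡ = ℤₚ.+-identityˡ _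
partialSum-complement c L pal (suc i) j i+j≡ = begin
    (partialSum c i + c i) + partialSum c j ≡⟨ cong (λ z → (partialSum c i + z) + partialSum c j) cᵢ≡cⱼ ⟩
    (partialSum c i + c j) + partialSum c j ≡⟨ move (partialSum c i) (c j) (partialSum c j) ⟩
    partialSum c i + (partialSum c j + c j) ≡⟨ partialSum-complement c L pal i (suc j) (trans (ℕₚ.+-suc i j) i+j≡) ⟩
    partialSum c (suc L) ∎
  where
  open ≡-Reasoning
  i+j≡L : i ℕ.+ j ≡ L
  i+j≡L = ℕₚ.suc-injective i+j≡
  cᵢ≡cⱼ : c i ≡ c j
  cᵢ≡cⱼ = begin
    c i           ≡⟨ pal i (subst (i ℕ.≤_) i+j≡L (ℕₚ.m≤m+n i j)) ⟩
    c (L ℕ.∸ i)   ≡⟨ cong (λ l → c (l ℕ.∸ i)) (sym i+j≡L) ⟩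
    c (i ℕ.+ j ℕ.∸ i) ≡⟨ cong c (ℕₚ.m+n∸m≡n i j) ⟩
    c j ∎
  move : ∀ x y z → (x + y) + z ≡ x + (z + y)
  move = solve-∀

Δ : (ℕ → ℤ) → ℕ → ℤ
Δ b i = b (suc i) - b i

Δ-step : ∀ (b c : ℕ → ℤ) a i →
  b (suc (suc i)) - + 2 * b (suc i) + b i + a * c i ≡ + 0 →
  Δ b (suc i) ≡ Δ b i - a * c i
Δ-step b c a i rec = begin
    Δ b (suc i)                        ≡⟨ split (b (suc (suc i))) (b (suc i)) (b i) (a * c i) ⟩
    recurrenceTerm + (Δ b i - a * c i) ≡⟨ cong (_+ (Δ b i - a * c i)) rec ⟩
    + 0 + (Δ b i - a * c i)            ≡⟨ ℤₚ.+-identityˡ _ ⟩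
    Δ b i - a * c i ∎
  where
  open ≡-Reasoning
  recurrenceTerm = b (suc (suc i)) - + 2 * b (suc i) + b i + a * c i
  split : ∀ x y z w → x - y ≡ (x - + 2 * y + z + w) + ((y - z) - w)
  split = solve-∀

Δ-closed-form : ∀ (b c : ℕ → ℤ) a L →
  (∀ i → i ℕ.≤ L → Δ b (suc i) ≡ Δ b i - a * c i) →
  ∀ i → i ℕ.≤ suc L → Δ b i ≡ Δ b 0 - a * partialSum c i
Δ-closed-form b c a L step zero _ = minusZero (Δ b 0) a
  where
  minusZero : ∀ x y → x ≡ x - y * + 0
  minusZero = solve-∀
Δ-closed-form b c a L step (suc i) (s≤s i≤L) = begin
    Δ b (suc i)                                 ≡⟨ step i i≤L ⟩
    Δ b i - a * c i                             ≡⟨ cong (_- a * c i) (Δ-closed-form b c a L step i (ℕₚ.m≤n⇒m≤1+n i≤L)) ⟩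
    (Δ b 0 - a * partialSum c i) - a * c i      ≡⟨ collect (Δ b 0) a (partialSum c i) (c i) ⟩
    Δ b 0 - a * (partialSum c i + c i) ∎
  where
  open ≡-Reasoning
  collect : ∀ x y s t → (x - y * s) - y * t ≡ x - y * (s + t)
  collect = solve-∀

Δ-antipalindromic : ∀ (b c : ℕ → ℤ) a L →
  (∀ i → i ℕ.≤ L → Δ b (suc i) ≡ Δ b i - a * c i) →
  Palindromic c L →
  + 2 * Δ b 0 ≡ a * partialSum c (suc L) →
  ∀ i j → i ℕ.+ j ≡ suc L → Δ b i + Δ b j ≡ + 0
Δ-antipalindromic b c a L step pal start i j i+j≡ = begin
    Δ b i + Δ b j                                           ≡⟨ cong₂ _+_ (closed i i≤) (closed j j≤) ⟩
    (Δ b 0 - a * partialSum c i) + (Δ b 0 - a * partialSum c j) ≡⟨ combine (Δ b 0) a (partialSum c i) (partialSum c j) ⟩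
    + 2 * Δ b 0 - a * (partialSum c i + partialSum c j)     ≡⟨ cong₂ (λ x y → x - a * y) start (partialSum-complement c L pal i j i+j≡) ⟩
    a * partialSum c (suc L) - a * partialSum c (suc L)     ≡⟨ ℤₚ.+-inverseʳ (a * partialSum c (suc L)) ⟩
    + 0 ∎
  where
  open ≡-Reasoning
  closed = Δ-closed-form b c a L step
  i≤ = subst (i ℕ.≤_) i+j≡ (ℕₚ.m≤m+n i j)
  j≤ = subst (j ℕ.≤_) i+j≡ (ℕₚ.m≤n+m j i)
  combine : ∀ x y s t → (x - y * s) + (x - y * t) ≡ + 2 * x - y * (s + t)
  combine = solve-∀

telescope : ∀ (b : ℕ → ℤ) N →
  (∀ i j → i ℕ.+ j ≡ suc N → Δ b i + Δ b j ≡ + 0) →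
  ∀ i j → i ℕ.+ j ≡ suc (suc N) → b i - b j ≡ b 0 - b (suc (suc N))
telescope b N anti zero j i+j≡ rewrite i+j≡ = refl
telescope b N anti (suc i) j i+j≡ = begin
    b (suc i) - b j                         ≡⟨ shift (b i) (b (suc i)) (b j) (b (suc j)) ⟩
    (b i - b (suc j)) + (Δ b i + Δ b j)     ≡⟨ cong₂ _+_ (telescope b N anti i (suc j) (trans (ℕₚ.+-suc i j) i+j≡))
                                                         (anti i j (ℕₚ.suc-injective i+j≡)) ⟩
    (b 0 - b (suc (suc N))) + + 0           ≡⟨ ℤₚ.+-identityʳ _ ⟩
    b 0 - b (suc (suc N)) ∎
  where
  open ≡-Reasoning
  shift : ∀ x x' y y' → x' - y ≡ (x - y') + ((x' - x) + (y' - y))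
  shift = solve-∀

-- When the length is odd the middle entry forces the constant to be 0, so b is
-- a palindrome on 0 … 2p + 2.
palindromic-from-Δ : ∀ (b : ℕ → ℤ) p →
  (∀ i j → i ℕ.+ j ≡ suc (p ℕ.+ p) → Δ b i + Δ b j ≡ + 0) →
  Palindromic b (suc (suc (p ℕ.+ p)))
palindromic-from-Δ b p anti i i≤ =
  ℤₚ.i-j≡0⇒i≡j (b i) (b (N ℕ.∸ i)) (trans (tele i (N ℕ.∸ i) (ℕₚ.m+[n∸m]≡n i≤)) constant≡0)
  where
  N = suc (suc (p ℕ.+ p))
  tele = telescope b (p ℕ.+ p) anti
  constant≡0 : b 0 - b N ≡ + 0
  constant≡0 = begin
    b 0 - b N             ≡⟨ sym (tele (suc p) (suc p) (cong suc (ℕₚ.+-suc p p))) ⟩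
    b (suc p) - b (suc p) ≡⟨ ℤₚ.+-inverseʳ (b (suc p)) ⟩
    + 0 ∎
    where open ≡-Reasoning

RowSymmetric : (ℕ → ℕ → ℤ) → ℕ → Set
RowSymmetric f n = ∀ k → 1 ℕ.≤ k → k ℕ.≤ 2 ℕ.* n ℕ.∸ 1 → f n k ≡ f n (2 ℕ.* n ℕ.∸ k)

-- Row n, read from position 1 on, occupies positions 0 … L of the shifted
-- sequence when 2n = L + 2; row symmetry is then exactly being a palindrome.
module RowIndexing (f : ℕ → ℕ → ℤ) (n L : ℕ) (2n≡ : 2 ℕ.* n ≡ suc (suc L)) where

  private
    reflectedIndex : ∀ i → i ℕ.≤ L → 2 ℕ.* n ℕ.∸ suc i ≡ suc (L ℕ.∸ i)
    reflectedIndex i i≤L = trans (cong (ℕ._∸ suc i) 2n≡) (ℕₚ.+-∸-assoc 1 i≤L)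

    lastIndex : 2 ℕ.* n ℕ.∸ 1 ≡ suc L
    lastIndex = cong (ℕ._∸ 1) 2n≡

  row⇒palindromic : RowSymmetric f n → Palindromic (λ i → f n (suc i)) L
  row⇒palindromic sym-n i i≤L =
    trans (sym-n (suc i) (s≤s z≤n) (subst (suc i ℕ.≤_) (sym lastIndex) (s≤s i≤L)))
          (cong (f n) (reflectedIndex i i≤L))

  palindromic⇒row : Palindromic (λ i → f n (suc i)) L → RowSymmetric f n
  palindromic⇒row pal (suc i) _ k≤ =
    trans (pal i i≤L) (cong (f n) (sym (reflectedIndex i i≤L)))
    where
    i≤L : i ℕ.≤ L
    i≤L = ℕₚ.≤-pred (subst (suc i ℕ.≤_) lastIndex k≤)

module Symmetry (f : ℕ → ℕ → ℤ) (rec : Recurrence f)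
  (boundary : ∀ n → 2 ℕ.≤ n → f n 2 - f n 1 ≡ + 2 * prevSum f n) where

  -- Row m + 1 has 2m + 1 entries, row m + 2 has 2m + 3.
  doubleLength : ∀ m → 2 ℕ.* suc m ≡ suc (suc (m ℕ.+ m))
  doubleLength = ℕRing.solve-∀

  doubleLength₂ : ∀ m → 2 ℕ.* suc (suc m) ≡ suc (suc (suc (suc (m ℕ.+ m))))
  doubleLength₂ = ℕRing.solve-∀

  rowStep : ∀ m → RowSymmetric f (suc m) → RowSymmetric f (suc (suc m))
  rowStep m sym-prev = Current.palindromic⇒row (palindromic-from-Δ b m anti)
    where
    n = suc (suc m)
    L = m ℕ.+ m
    module Current  = RowIndexing f n (suc (suc L)) (doubleLength₂ m)
    module Previous = RowIndexing f (suc m) L (doubleLength m)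
    b c : ℕ → ℤ
    b i = f n (suc i)
    c i = f (suc m) (suc i)

    prevLength : 2 ℕ.* n ℕ.∸ 3 ≡ suc L
    prevLength = cong (ℕ._∸ 3) (doubleLength₂ m)

    recurrenceAt : ∀ i → i ℕ.≤ L → b (suc (suc i)) - + 2 * b (suc i) + b i + + 4 * c i ≡ + 0
    recurrenceAt i i≤L =
      subst₂ (λ x y → f n (suc x) - + 2 * f n (suc y) + b i + + 4 * c i ≡ + 0)
             (ℕₚ.+-comm i 2) (ℕₚ.+-comm i 1)
             (rec n (suc i) (s≤s (s≤s z≤n)) (s≤s z≤n) (subst (suc i ℕ.≤_) (sym prevLength) (s≤s i≤L)))

    start : + 2 * Δ b 0 ≡ + 4 * partialSum c (suc L)
    start = begin
      + 2 * Δ b 0                          ≡⟨ cong (+ 2 *_) (boundary n (s≤s (s≤s z≤n))) ⟩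
      + 2 * (+ 2 * prevSum f n)            ≡⟨ cong (λ s → + 2 * (+ 2 * s))
                                                 (trans (cong (sumTo (f (suc m))) prevLength) (sumTo≡partialSum _ (suc L))) ⟩
      + 2 * (+ 2 * partialSum c (suc L))   ≡⟨ double (partialSum c (suc L)) ⟩
      + 4 * partialSum c (suc L) ∎
      where
      open ≡-Reasoning
      double : ∀ s → + 2 * (+ 2 * s) ≡ + 4 * s
      double = solve-∀

    -- The induction hypothesis makes c a palindrome, so the differences of b are antipalindromic.
    anti : ∀ i j → i ℕ.+ j ≡ suc L → Δ b i + Δ b j ≡ + 0
    anti = Δ-antipalindromic b c (+ 4) L
             (λ i i≤L → Δ-step b c (+ 4) i (recurrenceAt i i≤L))
             (Previous.row⇒palindromic sym-prev)
             start

  rowSymmetric : ∀ n → 1 ℕ.≤ n → RowSymmetric f n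
  rowSymmetric (suc zero)    _ (suc zero) _ _          = refl
  rowSymmetric (suc zero)    _ (suc (suc k)) _ (s≤s ())
  rowSymmetric (suc (suc m)) _ = rowStep m (rowSymmetric (suc m) (s≤s z≤n))

  symmetric : Symmetric f
  symmetric n k 1≤n = rowSymmetric n 1≤n k

boundaryG : ∀ g → IsG g → ∀ n → 2 ℕ.≤ n → g n 2 - g n 1 ≡ + 2 * prevSum g n
boundaryG g (_ , _ , init) n 2≤n rewrite proj₁ (init n 2≤n) | proj₂ (init n 2≤n) = ℤₚ.+-identityʳ _

boundaryH : ∀ h → IsH h → ∀ n → 2 ℕ.≤ n → h n 2 - h n 1 ≡ + 2 * prevSum h n
boundaryH h (_ , _ , init) n 2≤n rewrite proj₁ (init n 2≤n) | proj₂ (init n 2≤n) = threeMinusOne _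
  where
  threeMinusOne : ∀ s → + 3 * s - s ≡ + 2 * s
  threeMinusOne = solve-∀

corollary1p3 : (g h : ℕ → ℕ → ℤ) → IsG g → IsH h → Symmetric g × Symmetric h
corollary1p3 g h isG isH =
  Symmetry.symmetric g (proj₁ isG) (boundaryG g isG) ,
  Symmetry.symmetric h (proj₁ isH) (boundaryH h isH)
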